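{- Let $A$ be a totally ordered alphabet, and let $u=u_1\cdots u_k$ and $v=v_1\cdots v_l$ be nonempty words over $A$ with $\mathrm{alph}(u)\cap\mathrm{alph}(v)=\emptyset$. Then $$\sum_{x\in u\prec v}q^{\mathrm{maj}(x)}=\sum_{y\in\sigma\prec\tau}q^{\mathrm{maj}(y)},$$ (sums over the words of the half-shuffles, with multiplicities), where $\sigma=\mathrm{std}(u)$ and $\tau=\mathrm{std}(v)[k]$ if $u_k<v_l$, and $\sigma=\mathrm{std}(u)[l]$ and $\tau=\mathrm{std}(v)$ if $u_k>v_l$.
   Context: For nonempty words $u=u'a$, $v=v'b$ ($a,b$ letters), the left half-shuffle is $u\prec v=(u'\sqcup\!\sqcup v)\,a$, where $\sqcup\!\sqcup$ is the shuffle product. $\mathrm{std}(w)$ is the standardized word of $w$ (occurrences of the smallest letter labelled $1,2,\dots$ from left to right, then the next letter, etc.). $w[k]$ adds $k$ to every letter. $\mathrm{maj}(w)=\sum_{i:\,w_i>w_{i+1}}i$. $\mathrm{alph}(w)$ is the set of letters of $w$. -}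

module Defs where

open import Level using (0ℓ)
open import Data.Nat using (ℕ; zero; suc; _+_)
open import Data.Nat.Properties using (<-isStrictTotalOrder)
open import Data.List using (List; []; _∷_; _∷ʳ_; map; _++_; reverse; length; take; zip; upTo; filter)
open import Data.Product using (_,_)
open import Relation.Binary using (Rel; IsStrictTotalOrder)
open import Relation.Binary.PropositionalEquality using (_≡_)
open import Relation.Nullary using (yes; no)
import Data.Nat as ℕ

-- Shuffle product of two words, as the list of all shuffles WITH multiplicity.
shuffle : {A : Set} → List A → List A → List (List A)
shuffle [] v = v ∷ []
shuffle (a ∷ u) [] = (a ∷ u) ∷ []
shuffle (a ∷ u) (b ∷ v) =
  map (a ∷_) (shuffle u (b ∷ v)) ++ map (b ∷_) (shuffle (a ∷ u) v)

-- Left half-shuffle  (u' a) ≺ v = (u' ⧢ v) a, with multiplicity.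
-- Only meaningful for nonempty u (and v); for u = [] we return [] (never used).
halfShuffle : {A : Set} → List A → List A → List (List A)
halfShuffle u v with reverse u
... | [] = []
... | a ∷ ru = map (_∷ʳ a) (shuffle (reverse ru) v)

shift : List ℕ → ℕ → List ℕ
shift w k = map (_+ k) w

-- Coefficient of q^m in the polynomial  Σ_{x ∈ ws} q^{f x}  (with multiplicity)
coeff : {A : Set} → (A → ℕ) → List A → ℕ → ℕ
coeff f ws m = length (filter (λ x → f x ℕ.≟ m) ws)

module WordOps {A : Set} {_<_ : Rel A 0ℓ} (sto : IsStrictTotalOrder _≡_ _<_) where
  open IsStrictTotalOrder sto using (_<?_; _≟_)

  -- major index: sum of positions i (1-based) with w_i > w_{i+1}
  desc : A → A → ℕ → ℕ
  desc x y i with y <? x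
  ... | yes _ = i
  ... | no _ = 0

  -- majFrom i x r : contribution of the word x ∷ r whose first letter is at position i
  majFrom : ℕ → A → List A → ℕ
  majFrom i x [] = 0
  majFrom i x (y ∷ r) = desc x y i + majFrom (suc i) y r

  maj : List A → ℕ
  maj [] = 0
  maj (x ∷ r) = majFrom 1 x r

  std : List A → List ℕ
  std w = map (λ { (i , x) → suc (length (filter (_<? x) w)
                                  + length (filter (_≟ x) (take i w))) })
              (zip (upTo (length w)) w)

module ℕWords = WordOps <-isStrictTotalOrder

-- Appending the last letter a of u = u′a to a shuffle w of u′ and v adds to maj w a descent at
-- position |w| exactly when the last letter of w exceeds a.  Splitting the shuffles of u′ = u″c
-- and v by their last letter (c or b) and inducting shows that for disjoint alphabets the
-- multiset {maj x : x ∈ u ≺ v} is the exponent multiset of the Gaussian binomial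
-- [|u′| + |v| choose |u′|]_q shifted by maj u + maj v + (|v| if a < b): the two halves recombine
-- by one of the two q-Pascal rules, chosen by how a, b, c compare.  This depends only on the
-- lengths, the major indices and the comparison of the last letters, which standardization and
-- shifting preserve, and the shifted standardizations are separated as the formula requires.
module Submission where

open import Defs
open import Level using (0ℓ)
open import Data.Nat as ℕ using (ℕ; zero; suc; _+_; _*_; _≤_; z≤n; s≤s)
open import Data.Nat.Properties
  using (+-assoc; +-comm; +-identityʳ; +-suc; suc-injective; 0≢1+n; m≤m+n; n<1+n; m≤n⇒m≤1+n;
         ≤-reflexive; ≤-<-trans; <-asym; +-monoʳ-≤; +-monoʳ-<; +-monoˡ-≤; +-monoˡ-<; +-cancelʳ-<;
         <-isStrictTotalOrder; module ≤-Reasoning)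
open import Data.Nat.Tactic.RingSolver using (solve)
open import Data.List
  using (List; []; _∷_; _∷ʳ_; _++_; map; length; filter; take; zip; applyUpTo; initLast; _∷ʳ′_)
open import Data.List.Properties
  using (map-++; map-∘; map-cong; ++-assoc; ∷ʳ-++; reverse-++; reverse-involutive; length-++;
         length-map; length-filter; filter-++; filter-accept; filter-reject)
open import Data.List.Membership.Propositional using (_∈_)
open import Data.List.Membership.Propositional.Properties using (∈-++⁺ˡ; ∈-++⁺ʳ; ∈-map⁻)
open import Data.List.Relation.Unary.Any using (here)
open import Data.List.Relation.Unary.All using (All)
import Data.List.Relation.Unary.All as All
open import Data.List.Relation.Unary.All.Properties using () renaming (++⁺ to All-++⁺; map⁺ to All-map⁺)
open import Data.List.Relation.Binary.Disjoint.Propositional using (Disjoint)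
import Data.List.Relation.Binary.Disjoint.Propositional.Properties as Disjoint
open import Data.List.Relation.Binary.Permutation.Propositional
  using (_↭_; ↭-refl; ↭-sym; ↭-trans; ↭-reflexive; prep; swap; module PermutationReasoning)
open import Data.List.Relation.Binary.Permutation.Propositional.Properties
  using (map⁺; ++⁺; ++⁺ˡ; ++⁺ʳ; ++-comm; shifts; filter-↭; ↭-length)
open import Data.Product using (_×_; _,_; proj₁; proj₂)
open import Data.Sum using (_⊎_; inj₁; inj₂)
open import Data.Unit using (tt)
open import Data.Empty using (⊥; ⊥-elim)
open import Function using (_∘_; case_of_)
open import Relation.Nullary using (Dec; yes; no; ¬_)
open import Relation.Unary using (Decidable)
open import Relation.Binary using (Rel; IsStrictTotalOrder; Tri; tri<; tri≈; tri>)
open import Relation.Binary.PropositionalEquality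

-- Gaussian binomials

-- The exponents of q, with multiplicity, in the Gaussian binomial [ i + j choose i ]_q.
gaussian : ℕ → ℕ → List ℕ
gaussian zero    j       = 0 ∷ []
gaussian (suc i) zero    = 0 ∷ []
gaussian (suc i) (suc j) = gaussian i (suc j) ++ shift (gaussian (suc i) j) (suc i)

shift-++ : ∀ xs ys k → shift (xs ++ ys) k ≡ shift xs k ++ shift ys k
shift-++ xs ys k = map-++ (_+ k) xs ys

shift-shift : ∀ xs m n → shift (shift xs m) n ≡ shift xs (m + n)
shift-shift xs m n = trans (sym (map-∘ xs)) (map-cong (λ x → +-assoc x m n) xs)

gaussian-pascalʳ : ∀ i j →
  gaussian (suc i) (suc j) ↭ shift (gaussian i (suc j)) (suc j) ++ gaussian (suc i) j
gaussian-pascalʳ zero zero = swap 0 1 ↭-refl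
gaussian-pascalʳ zero (suc j) = begin
    0 ∷ shift (gaussian 1 (suc j)) 1       ↭⟨ prep 0 (map⁺ (_+ 1) (gaussian-pascalʳ zero j)) ⟩
    0 ∷ suc j + 1 ∷ shift (gaussian 1 j) 1 ≡⟨ cong (λ n → 0 ∷ n ∷ shift (gaussian 1 j) 1) (+-comm (suc j) 1) ⟩
    0 ∷ suc (suc j) ∷ shift (gaussian 1 j) 1 ↭⟨ swap 0 (suc (suc j)) ↭-refl ⟩
    suc (suc j) ∷ gaussian 1 (suc j)       ∎
  where open PermutationReasoning
gaussian-pascalʳ (suc i) zero = begin
    gaussian (suc i) 1 ++ suc (suc i) ∷ []    ↭⟨ ++⁺ʳ _ (gaussian-pascalʳ i zero) ⟩
    (g ++ 0 ∷ []) ++ suc (suc i) ∷ []         ≡⟨ ++-assoc g _ _ ⟩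
    g ++ 0 ∷ suc (suc i) ∷ []                 ↭⟨ ++⁺ˡ g (swap 0 (suc (suc i)) ↭-refl) ⟩
    g ++ suc (suc i) ∷ 0 ∷ []                 ≡⟨ cong (λ n → g ++ n ∷ 0 ∷ []) (+-comm 1 (suc i)) ⟩
    g ++ suc i + 1 ∷ 0 ∷ []                   ≡⟨ sym (++-assoc g _ _) ⟩
    (g ++ shift (suc i ∷ []) 1) ++ 0 ∷ []     ≡⟨ cong (_++ 0 ∷ []) (sym (shift-++ (gaussian i 1) _ 1)) ⟩
    shift (gaussian (suc i) 1) 1 ++ 0 ∷ []    ∎
  where
  open PermutationReasoning
  g = shift (gaussian i 1) 1
gaussian-pascalʳ (suc i) (suc j) = begin
    gaussian (suc i) (suc (suc j)) ++ shift (gaussian (suc (suc i)) (suc j)) (suc (suc i))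
      ↭⟨ ++⁺ (gaussian-pascalʳ i (suc j)) (map⁺ (_+ suc (suc i)) (gaussian-pascalʳ (suc i) j)) ⟩
    (shift a (suc (suc j)) ++ b) ++ shift (shift b (suc j) ++ c) (suc (suc i))
      ≡⟨ distribute ⟩
    shift a (suc (suc j)) ++ b ++ shift b (suc j + suc (suc i)) ++ c′
      ↭⟨ ++⁺ˡ (shift a (suc (suc j))) (shifts b (shift b (suc j + suc (suc i)))) ⟩
    shift a (suc (suc j)) ++ shift b (suc j + suc (suc i)) ++ b ++ c′
      ≡⟨ collect ⟩
    shift (gaussian (suc i) (suc (suc j))) (suc (suc j)) ++ gaussian (suc (suc i)) (suc j)
      ∎
  where
  open PermutationReasoning
  a = gaussian i (suc (suc j))
  b = gaussian (suc i) (suc j)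
  c = gaussian (suc (suc i)) j
  c′ = shift c (suc (suc i))
  distribute : (shift a (suc (suc j)) ++ b) ++ shift (shift b (suc j) ++ c) (suc (suc i))
             ≡ shift a (suc (suc j)) ++ b ++ shift b (suc j + suc (suc i)) ++ c′
  distribute = trans (++-assoc (shift a (suc (suc j))) b _)
    (cong (λ z → shift a (suc (suc j)) ++ b ++ z)
      (trans (shift-++ (shift b (suc j)) c _) (cong (_++ c′) (shift-shift b (suc j) _))))
  exchange : suc j + suc (suc i) ≡ suc i + suc (suc j)
  exchange = solve (i ∷ j ∷ [])
  collect : shift a (suc (suc j)) ++ shift b (suc j + suc (suc i)) ++ b ++ c′
          ≡ shift (gaussian (suc i) (suc (suc j))) (suc (suc j)) ++ b ++ c′
  collect = trans (cong (λ n → shift a (suc (suc j)) ++ shift b n ++ b ++ c′) exchange)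
    (trans (cong (λ z → shift a (suc (suc j)) ++ z ++ b ++ c′) (sym (shift-shift b (suc i) _)))
      (trans (sym (++-assoc (shift a (suc (suc j))) _ _))
        (cong (_++ b ++ c′) (sym (shift-++ a (shift b (suc i)) _)))))

gaussian-sym : ∀ i j → gaussian i j ↭ gaussian j i
gaussian-sym zero zero = ↭-refl
gaussian-sym zero (suc j) = ↭-refl
gaussian-sym (suc i) zero = ↭-refl
gaussian-sym (suc i) (suc j) = begin
    gaussian i (suc j) ++ shift (gaussian (suc i) j) (suc i)  ↭⟨ ++-comm (gaussian i (suc j)) _ ⟩
    shift (gaussian (suc i) j) (suc i) ++ gaussian i (suc j)
      ↭⟨ ++⁺ (map⁺ (_+ suc i) (gaussian-sym (suc i) j)) (gaussian-sym i (suc j)) ⟩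
    shift (gaussian j (suc i)) (suc i) ++ gaussian (suc j) i  ↭⟨ ↭-sym (gaussian-pascalʳ j i) ⟩
    gaussian (suc j) (suc i)                                  ∎
  where open PermutationReasoning

PascalShifts : ℕ → ℕ → ℕ → ℕ → ℕ → Set
PascalShifts i j P Q E = (P ≡ E × Q ≡ suc i + E) ⊎ (P ≡ suc j + E × Q ≡ E)

gaussian-split : ∀ i j {P Q E} → PascalShifts i j P Q E →
  shift (gaussian i (suc j)) P ++ shift (gaussian (suc i) j) Q ↭ shift (gaussian (suc i) (suc j)) E
gaussian-split i j {E = E} (inj₁ (refl , refl)) = ↭-reflexive (begin
    shift (gaussian i (suc j)) E ++ shift (gaussian (suc i) j) (suc i + E)
      ≡⟨ cong (shift (gaussian i (suc j)) E ++_) (sym (shift-shift (gaussian (suc i) j) (suc i) E)) ⟩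
    shift (gaussian i (suc j)) E ++ shift (shift (gaussian (suc i) j) (suc i)) E
      ≡⟨ sym (shift-++ (gaussian i (suc j)) _ E) ⟩
    shift (gaussian (suc i) (suc j)) E ∎)
  where open ≡-Reasoning
gaussian-split i j {E = E} (inj₂ (refl , refl)) = begin
    shift (gaussian i (suc j)) (suc j + E) ++ shift (gaussian (suc i) j) E
      ≡⟨ cong (_++ shift (gaussian (suc i) j) E) (sym (shift-shift (gaussian i (suc j)) (suc j) E)) ⟩
    shift (shift (gaussian i (suc j)) (suc j)) E ++ shift (gaussian (suc i) j) E
      ≡⟨ sym (shift-++ (shift (gaussian i (suc j)) (suc j)) _ E) ⟩
    shift (shift (gaussian i (suc j)) (suc j) ++ gaussian (suc i) j) E
      ↭⟨ map⁺ (_+ E) (↭-sym (gaussian-pascalʳ i j)) ⟩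
    shift (gaussian (suc i) (suc j)) E ∎
  where open PermutationReasoning

-- d, e, f, g stand for the descent indicators of (b, c), (c, a), (b, a), (c, b) in pascalShifts-desc.
pascalShifts-indicators : ∀ mu mv i j d e f g → d + g ≡ 1 → d + e ≡ f ⊎ d + e ≡ suc f →
  PascalShifts i j (mu + mv + d * suc j + e * suc (i + suc j))
                   (mv + mu + g * suc i + f * suc (suc i + j))
                   (mu + e * suc i + mv + f * suc j)
pascalShifts-indicators mu mv i j 0 e _ _ refl (inj₁ refl) =
  inj₁ (solve (mu ∷ mv ∷ i ∷ j ∷ e ∷ []) , solve (mu ∷ mv ∷ i ∷ j ∷ e ∷ []))
pascalShifts-indicators mu mv i j 0 _ f _ refl (inj₂ refl) =
  inj₂ (solve (mu ∷ mv ∷ i ∷ j ∷ f ∷ []) , solve (mu ∷ mv ∷ i ∷ j ∷ f ∷ []))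
pascalShifts-indicators mu mv i j 1 e _ _ refl (inj₁ refl) =
  inj₁ (solve (mu ∷ mv ∷ i ∷ j ∷ e ∷ []) , solve (mu ∷ mv ∷ i ∷ j ∷ e ∷ []))
pascalShifts-indicators mu mv i j 1 e _ _ refl (inj₂ refl) =
  inj₂ (solve (mu ∷ mv ∷ i ∷ j ∷ e ∷ []) , solve (mu ∷ mv ∷ i ∷ j ∷ e ∷ []))
pascalShifts-indicators mu mv i j (suc (suc d)) e f g () _

-- Words and shuffles

++-interchange : ∀ {X : Set} (ws xs ys zs : List X) → (ws ++ xs) ++ (ys ++ zs) ↭ (ws ++ ys) ++ (xs ++ zs)
++-interchange ws xs ys zs = begin
  (ws ++ xs) ++ (ys ++ zs) ≡⟨ ++-assoc ws xs _ ⟩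
  ws ++ xs ++ ys ++ zs     ↭⟨ ++⁺ˡ ws (shifts xs ys) ⟩
  ws ++ ys ++ xs ++ zs     ≡⟨ ++-assoc ws ys _ ⟨
  (ws ++ ys) ++ (xs ++ zs) ∎
  where open PermutationReasoning

module _ {A : Set} where

  length-∷ʳ : ∀ (xs : List A) x → length (xs ∷ʳ x) ≡ suc (length xs)
  length-∷ʳ []       x = refl
  length-∷ʳ (y ∷ xs) x = cong suc (length-∷ʳ xs x)

  halfShuffle-∷ʳ : ∀ u′ (a : A) v → halfShuffle (u′ ∷ʳ a) v ≡ map (_∷ʳ a) (shuffle u′ v)
  halfShuffle-∷ʳ u′ a v rewrite reverse-++ u′ (a ∷ []) | reverse-involutive u′ = refl

  shuffle-identityʳ : ∀ (u : List A) → shuffle u [] ≡ u ∷ []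
  shuffle-identityʳ []      = refl
  shuffle-identityʳ (x ∷ u) = refl

  shuffle-comm : ∀ (u v : List A) → shuffle u v ↭ shuffle v u
  shuffle-comm []      v       = ↭-reflexive (sym (shuffle-identityʳ v))
  shuffle-comm (a ∷ u) []      = ↭-refl
  shuffle-comm (a ∷ u) (b ∷ v) =
    ↭-trans (++⁺ (map⁺ (a ∷_) (shuffle-comm u (b ∷ v))) (map⁺ (b ∷_) (shuffle-comm (a ∷ u) v)))
            (++-comm (map (a ∷_) (shuffle (b ∷ v) u)) _)

  map-∷-∷ʳ : ∀ x y (ws : List (List A)) → map (x ∷_) (map (_∷ʳ y) ws) ≡ map (_∷ʳ y) (map (x ∷_) ws)
  map-∷-∷ʳ x y ws = trans (sym (map-∘ ws)) (map-∘ ws)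

  shuffle-∷ʳ : ∀ (u v : List A) c b →
    shuffle (u ∷ʳ c) (v ∷ʳ b) ↭ map (_∷ʳ c) (shuffle u (v ∷ʳ b)) ++ map (_∷ʳ b) (shuffle (u ∷ʳ c) v)
  shuffle-∷ʳ [] [] c b = swap _ _ ↭-refl
  shuffle-∷ʳ [] (y ∷ v) c b = begin
      (c ∷ y ∷ v ∷ʳ b) ∷ map (y ∷_) (shuffle (c ∷ []) (v ∷ʳ b))
    ↭⟨ prep _ (map⁺ (y ∷_) (shuffle-∷ʳ [] v c b)) ⟩
      (c ∷ y ∷ v ∷ʳ b) ∷ (y ∷ v ∷ʳ b ∷ʳ c) ∷ map (y ∷_) (map (_∷ʳ b) (shuffle (c ∷ []) v))
    ↭⟨ swap _ _ ↭-refl ⟩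
      (y ∷ v ∷ʳ b ∷ʳ c) ∷ (c ∷ y ∷ v ∷ʳ b) ∷ map (y ∷_) (map (_∷ʳ b) (shuffle (c ∷ []) v))
    ≡⟨ cong (λ ws → (y ∷ v ∷ʳ b ∷ʳ c) ∷ (c ∷ y ∷ v ∷ʳ b) ∷ ws) (map-∷-∷ʳ y b _) ⟩
      (y ∷ v ∷ʳ b ∷ʳ c) ∷ map (_∷ʳ b) (shuffle (c ∷ []) (y ∷ v))
    ∎
    where open PermutationReasoning
  shuffle-∷ʳ (x ∷ u) [] c b = begin
      map (x ∷_) (shuffle (u ∷ʳ c) (b ∷ [])) ++ (b ∷ x ∷ u ∷ʳ c) ∷ []
    ↭⟨ ++⁺ʳ _ (map⁺ (x ∷_) (shuffle-∷ʳ u [] c b)) ⟩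
      map (x ∷_) (map (_∷ʳ c) (shuffle u (b ∷ [])) ++ map (_∷ʳ b) (shuffle (u ∷ʳ c) [])) ++ (b ∷ x ∷ u ∷ʳ c) ∷ []
    ≡⟨ cong (λ ws → ws ++ (b ∷ x ∷ u ∷ʳ c) ∷ [])
            (trans (map-++ (x ∷_) (map (_∷ʳ c) (shuffle u (b ∷ []))) _)
                   (cong₂ _++_ (map-∷-∷ʳ x c _) (cong (map (x ∷_) ∘ map (_∷ʳ b)) (shuffle-identityʳ (u ∷ʳ c))))) ⟩
      (map (_∷ʳ c) ws ++ (x ∷ u ∷ʳ c ∷ʳ b) ∷ []) ++ (b ∷ x ∷ u ∷ʳ c) ∷ []
    ↭⟨ ++-interchange (map (_∷ʳ c) ws) ((x ∷ u ∷ʳ c ∷ʳ b) ∷ []) ((b ∷ x ∷ u ∷ʳ c) ∷ []) [] ⟩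
      (map (_∷ʳ c) ws ++ (b ∷ x ∷ u ∷ʳ c) ∷ []) ++ (x ∷ u ∷ʳ c ∷ʳ b) ∷ []
    ≡⟨ cong (_++ (x ∷ u ∷ʳ c ∷ʳ b) ∷ []) (map-++ (_∷ʳ c) ws ((b ∷ x ∷ u) ∷ [])) ⟨
      map (_∷ʳ c) (shuffle (x ∷ u) (b ∷ [])) ++ map (_∷ʳ b) (shuffle (x ∷ u ∷ʳ c) [])
    ∎
    where
    open PermutationReasoning
    ws = map (x ∷_) (shuffle u (b ∷ []))
  shuffle-∷ʳ (x ∷ u) (y ∷ v) c b = begin
      map (x ∷_) (shuffle (u ∷ʳ c) (y ∷ v ∷ʳ b)) ++ map (y ∷_) (shuffle (x ∷ u ∷ʳ c) (v ∷ʳ b))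
    ↭⟨ ++⁺ (map⁺ (x ∷_) (shuffle-∷ʳ u (y ∷ v) c b)) (map⁺ (y ∷_) (shuffle-∷ʳ (x ∷ u) v c b)) ⟩
      map (x ∷_) (map (_∷ʳ c) xc ++ map (_∷ʳ b) xb) ++ map (y ∷_) (map (_∷ʳ c) yc ++ map (_∷ʳ b) yb)
    ≡⟨ cong₂ _++_ (trans (map-++ (x ∷_) (map (_∷ʳ c) xc) _) (cong₂ _++_ (map-∷-∷ʳ x c xc) (map-∷-∷ʳ x b xb)))
                  (trans (map-++ (y ∷_) (map (_∷ʳ c) yc) _) (cong₂ _++_ (map-∷-∷ʳ y c yc) (map-∷-∷ʳ y b yb))) ⟩
      (map (_∷ʳ c) (map (x ∷_) xc) ++ map (_∷ʳ b) (map (x ∷_) xb))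
        ++ (map (_∷ʳ c) (map (y ∷_) yc) ++ map (_∷ʳ b) (map (y ∷_) yb))
    ↭⟨ ++-interchange (map (_∷ʳ c) (map (x ∷_) xc)) _ _ _ ⟩
      (map (_∷ʳ c) (map (x ∷_) xc) ++ map (_∷ʳ c) (map (y ∷_) yc))
        ++ (map (_∷ʳ b) (map (x ∷_) xb) ++ map (_∷ʳ b) (map (y ∷_) yb))
    ≡⟨ cong₂ _++_ (map-++ (_∷ʳ c) (map (x ∷_) xc) _) (map-++ (_∷ʳ b) (map (x ∷_) xb) _) ⟨
      map (_∷ʳ c) (shuffle (x ∷ u) (y ∷ v ∷ʳ b)) ++ map (_∷ʳ b) (shuffle (x ∷ u ∷ʳ c) (y ∷ v))
    ∎
    where
    open PermutationReasoning
    xc = shuffle u (y ∷ v ∷ʳ b)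
    xb = shuffle (u ∷ʳ c) (y ∷ v)
    yc = shuffle (x ∷ u) (v ∷ʳ b)
    yb = shuffle (x ∷ u ∷ʳ c) v

  ∈-∷ʳ : ∀ (xs : List A) x → x ∈ xs ∷ʳ x
  ∈-∷ʳ xs x = ∈-++⁺ʳ xs (here refl)

  Disjoint-∷ʳ⁻ : ∀ {xs ys : List A} {x} → Disjoint (xs ∷ʳ x) ys → Disjoint xs ys
  Disjoint-∷ʳ⁻ xs#ys (p , q) = xs#ys (∈-++⁺ˡ p , q)

  Disjoint-last : ∀ {xs ys : List A} {x y} → Disjoint (xs ∷ʳ x) (ys ∷ʳ y) → x ≢ y
  Disjoint-last {xs} {ys} xs#ys refl = xs#ys (∈-∷ʳ xs _ , ∈-∷ʳ ys _)

  shuffle-length : ∀ (u v : List A) → All (λ w → length w ≡ length u + length v) (shuffle u v)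
  shuffle-length []      v       = refl All.∷ All.[]
  shuffle-length (a ∷ u) []      = sym (+-identityʳ _) All.∷ All.[]
  shuffle-length (a ∷ u) (b ∷ v) = All-++⁺
    (All-map⁺ (All.map (cong suc) (shuffle-length u (b ∷ v))))
    (All-map⁺ (All.map (λ e → trans (cong suc e) (sym (+-suc (suc (length u)) (length v)))) (shuffle-length (a ∷ u) v)))

-- Descents and the major index of half-shuffles

module Descents {A : Set} {_<_ : Rel A 0ℓ} (sto : IsStrictTotalOrder _≡_ _<_) where
  open WordOps sto
  open IsStrictTotalOrder sto using (_<?_; compare) renaming (trans to <-trans; irrefl to <-irrefl)

  desc-< : ∀ {x y} i → y < x → desc x y i ≡ i
  desc-< {x} {y} i y<x with y <? x
  ... | yes _ = refl
  ... | no y≮x = ⊥-elim (y≮x y<x)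

  desc-≮ : ∀ {x y} i → ¬ y < x → desc x y i ≡ 0
  desc-≮ {x} {y} i y≮x with y <? x
  ... | yes y<x = ⊥-elim (y≮x y<x)
  ... | no _ = refl

  desc-indicator : ∀ x y i → desc x y i ≡ desc x y 1 * i
  desc-indicator x y i with y <? x
  ... | yes _ = sym (+-identityʳ i)
  ... | no _ = refl

  desc-flip : ∀ {x y} → x ≢ y → desc x y 1 + desc y x 1 ≡ 1
  desc-flip {x} {y} x≢y = cases (compare x y)
    where
    cases : Tri (x < y) (x ≡ y) (y < x) → desc x y 1 + desc y x 1 ≡ 1
    cases (tri< x<y _ y≮x) rewrite desc-≮ 1 y≮x | desc-< 1 x<y = refl
    cases (tri≈ _ x≡y _)   = ⊥-elim (x≢y x≡y)
    cases (tri> x≮y _ y<x) rewrite desc-< 1 y<x | desc-≮ 1 x≮y = refl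

  desc-triangle : ∀ {a b c} → b ≢ c →
    desc b c 1 + desc c a 1 ≡ desc b a 1 ⊎ desc b c 1 + desc c a 1 ≡ suc (desc b a 1)
  desc-triangle {a} {b} {c} b≢c = cases (c <? b) (a <? c) (a <? b)
    where
    Triangle = desc b c 1 + desc c a 1 ≡ desc b a 1 ⊎ desc b c 1 + desc c a 1 ≡ suc (desc b a 1)
    cases : Dec (c < b) → Dec (a < c) → Dec (a < b) → Triangle
    cases (yes c<b) (yes a<c) _
      rewrite desc-< 1 c<b | desc-< 1 a<c | desc-< 1 (<-trans a<c c<b) = inj₂ refl
    cases (yes c<b) (no a≮c) (yes a<b) rewrite desc-< 1 c<b | desc-≮ 1 a≮c | desc-< 1 a<b = inj₁ refl
    cases (yes c<b) (no a≮c) (no a≮b)  rewrite desc-< 1 c<b | desc-≮ 1 a≮c | desc-≮ 1 a≮b = inj₂ refl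
    cases (no c≮b) (yes a<c) (yes a<b) rewrite desc-≮ 1 c≮b | desc-< 1 a<c | desc-< 1 a<b = inj₁ refl
    cases (no c≮b) (yes a<c) (no a≮b)  rewrite desc-≮ 1 c≮b | desc-< 1 a<c | desc-≮ 1 a≮b = inj₂ refl
    cases (no c≮b) (no a≮c) (no a≮b)   rewrite desc-≮ 1 c≮b | desc-≮ 1 a≮c | desc-≮ 1 a≮b = inj₁ refl
    cases (no c≮b) (no a≮c) (yes a<b) with compare b c
    ... | tri< b<c _ _ = ⊥-elim (a≮c (<-trans a<b b<c))
    ... | tri≈ _ b≡c _ = ⊥-elim (b≢c b≡c)
    ... | tri> _ _ c<b = ⊥-elim (c≮b c<b)

  pascalShifts-desc : ∀ {a b c} → b ≢ c → ∀ mu mv i j →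
    PascalShifts i j (mu + mv + desc b c (suc j) + desc c a (suc (i + suc j)))
                     (mv + mu + desc c b (suc i) + desc b a (suc (suc i + j)))
                     (mu + desc c a (suc i) + mv + desc b a (suc j))
  pascalShifts-desc {a} {b} {c} b≢c mu mv i j
    rewrite desc-indicator b c (suc j) | desc-indicator c a (suc (i + suc j))
          | desc-indicator c b (suc i) | desc-indicator b a (suc (suc i + j))
          | desc-indicator c a (suc i) | desc-indicator b a (suc j)
    = pascalShifts-indicators mu mv i j (desc b c 1) (desc c a 1) (desc b a 1) (desc c b 1)
        (desc-flip b≢c) (desc-triangle b≢c)

  majFrom-∷ʳ-∷ʳ : ∀ i z w x y →
    majFrom i z (w ∷ʳ x ∷ʳ y) ≡ majFrom i z (w ∷ʳ x) + desc x y (i + suc (length w))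
  majFrom-∷ʳ-∷ʳ i z [] x y
    rewrite +-identityʳ (desc x y (suc i)) | +-identityʳ (desc z x i) | +-comm i 1 = refl
  majFrom-∷ʳ-∷ʳ i z (v ∷ w) x y = begin
    desc z v i + majFrom (suc i) v (w ∷ʳ x ∷ʳ y)
      ≡⟨ cong (desc z v i +_) (majFrom-∷ʳ-∷ʳ (suc i) v w x y) ⟩
    desc z v i + (majFrom (suc i) v (w ∷ʳ x) + desc x y (suc i + suc (length w)))
      ≡⟨ +-assoc (desc z v i) _ _ ⟨
    desc z v i + majFrom (suc i) v (w ∷ʳ x) + desc x y (suc i + suc (length w))
      ≡⟨ cong (λ k → desc z v i + majFrom (suc i) v (w ∷ʳ x) + desc x y k) (+-suc i (suc (length w))) ⟨
    desc z v i + majFrom (suc i) v (w ∷ʳ x) + desc x y (i + suc (suc (length w)))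
      ∎
    where open ≡-Reasoning

  maj-∷ʳ-∷ʳ : ∀ w x y → maj (w ∷ʳ x ∷ʳ y) ≡ maj (w ∷ʳ x) + desc x y (suc (length w))
  maj-∷ʳ-∷ʳ []      x y = +-identityʳ (desc x y 1)
  maj-∷ʳ-∷ʳ (z ∷ w) x y = majFrom-∷ʳ-∷ʳ 1 z w x y

  majs-∷ʳ-∷ʳ : ∀ {n ws} x y → All (λ w → length w ≡ n) ws →
    map maj (map (_∷ʳ y) (map (_∷ʳ x) ws)) ≡ shift (map maj (map (_∷ʳ x) ws)) (desc x y (suc n))
  majs-∷ʳ-∷ʳ x y All.[]                      = refl
  majs-∷ʳ-∷ʳ x y (All._∷_ {w} refl lengths) = cong₂ _∷_ (maj-∷ʳ-∷ʳ w x y) (majs-∷ʳ-∷ʳ x y lengths)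

  majs-shuffle-∷ʳ : ∀ u v c a {g E n} → length u + length v ≡ n →
    map maj (map (_∷ʳ c) (shuffle u v)) ↭ shift g E →
    map maj (map (_∷ʳ a) (map (_∷ʳ c) (shuffle u v))) ↭ shift g (E + desc c a (suc n))
  majs-shuffle-∷ʳ u v c a {g} {E} refl majs↭g = begin
    map maj (map (_∷ʳ a) (map (_∷ʳ c) (shuffle u v))) ≡⟨ majs-∷ʳ-∷ʳ c a (shuffle-length u v) ⟩
    shift (map maj (map (_∷ʳ c) (shuffle u v))) d    ↭⟨ map⁺ (_+ d) majs↭g ⟩
    shift (shift g E) d                               ≡⟨ shift-shift g E d ⟩
    shift g (E + d)                                   ∎
    where
    open PermutationReasoning
    d = desc c a (suc (length u + length v))

  majOffset : List A → A → List A → A → ℕ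
  majOffset u′ a v′ b = maj (u′ ∷ʳ a) + maj (v′ ∷ʳ b) + desc b a (suc (length v′))

  -- Induction on n = |u′| + |v′|: the second recursive call exchanges the roles of u and v.
  majs-∷ʳ-shuffle-↭-gaussian : ∀ n u′ a v′ b → length u′ + length v′ ≡ n → Disjoint (u′ ∷ʳ a) (v′ ∷ʳ b) →
    map maj (map (_∷ʳ a) (shuffle u′ (v′ ∷ʳ b)))
      ↭ shift (gaussian (length u′) (suc (length v′))) (majOffset u′ a v′ b)
  majs-∷ʳ-shuffle-↭-gaussian n u′ a v′ b len u#v with initLast u′
  ... | [] = ↭-reflexive (cong (_∷ []) (maj-∷ʳ-∷ʳ v′ b a))
  majs-∷ʳ-shuffle-↭-gaussian zero _ a v′ b len u#v | u″ ∷ʳ′ c =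
    ⊥-elim (0≢1+n (trans (sym len) (cong (_+ length v′) (length-∷ʳ u″ c))))
  majs-∷ʳ-shuffle-↭-gaussian (suc n) _ a v′ b len u#v | u″ ∷ʳ′ c = begin
      map maj (map (_∷ʳ a) (shuffle (u″ ∷ʳ c) (v′ ∷ʳ b)))
    ↭⟨ map⁺ maj (map⁺ (_∷ʳ a) (shuffle-∷ʳ u″ v′ c b)) ⟩
      map maj (map (_∷ʳ a) (endsWith-c ++ endsWith-b))
    ≡⟨ trans (cong (map maj) (map-++ (_∷ʳ a) endsWith-c endsWith-b)) (map-++ maj (map (_∷ʳ a) endsWith-c) _) ⟩
      map maj (map (_∷ʳ a) endsWith-c) ++ map maj (map (_∷ʳ a) endsWith-b)
    ↭⟨ ++⁺ majs-c majs-b ⟩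
      shift (gaussian i (suc j)) (mu + mv + desc b c (suc j) + desc c a (suc (i + suc j)))
        ++ shift (gaussian (suc i) j) (mv + mu + desc c b (suc i) + desc b a (suc (suc i + j)))
    ↭⟨ gaussian-split i j (pascalShifts-desc (≢-sym (Disjoint-last u″#v)) mu mv i j) ⟩
      shift (gaussian (suc i) (suc j)) (mu + desc c a (suc i) + mv + desc b a (suc j))
    ≡⟨ cong₂ (λ k m → shift (gaussian k (suc j)) (m + mv + desc b a (suc j)))
             (length-∷ʳ u″ c) (maj-∷ʳ-∷ʳ u″ c a) ⟨
      shift (gaussian (length (u″ ∷ʳ c)) (suc j)) (majOffset (u″ ∷ʳ c) a v′ b)
    ∎
    where
    open PermutationReasoning
    i = length u″
    j = length v′
    mu = maj (u″ ∷ʳ c)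
    mv = maj (v′ ∷ʳ b)
    endsWith-c = map (_∷ʳ c) (shuffle u″ (v′ ∷ʳ b))
    endsWith-b = map (_∷ʳ b) (shuffle (u″ ∷ʳ c) v′)
    i+j≡n : i + j ≡ n
    i+j≡n = suc-injective (trans (cong (_+ j) (sym (length-∷ʳ u″ c))) len)
    u″#v : Disjoint (u″ ∷ʳ c) (v′ ∷ʳ b)
    u″#v = Disjoint-∷ʳ⁻ u#v
    majs-c : map maj (map (_∷ʳ a) endsWith-c) ↭ shift (gaussian i (suc j)) _
    majs-c = majs-shuffle-∷ʳ u″ (v′ ∷ʳ b) c a (cong (i +_) (length-∷ʳ v′ b))
      (majs-∷ʳ-shuffle-↭-gaussian n u″ c v′ b i+j≡n u″#v)
    majs-b : map maj (map (_∷ʳ a) endsWith-b) ↭ shift (gaussian (suc i) j) _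
    majs-b = majs-shuffle-∷ʳ (u″ ∷ʳ c) v′ b a (cong (_+ j) (length-∷ʳ u″ c))
      (↭-trans (map⁺ maj (map⁺ (_∷ʳ b) (shuffle-comm (u″ ∷ʳ c) v′)))
        (↭-trans (majs-∷ʳ-shuffle-↭-gaussian n v′ b u″ c (trans (+-comm j i) i+j≡n) (Disjoint.sym u″#v))
                 (map⁺ (_+ majOffset v′ b u″ c) (gaussian-sym j (suc i)))))

  majs-halfShuffle-↭-gaussian : ∀ u′ a v′ b → Disjoint (u′ ∷ʳ a) (v′ ∷ʳ b) →
    map maj (halfShuffle (u′ ∷ʳ a) (v′ ∷ʳ b))
      ↭ shift (gaussian (length u′) (suc (length v′))) (majOffset u′ a v′ b)
  majs-halfShuffle-↭-gaussian u′ a v′ b u#v rewrite halfShuffle-∷ʳ u′ a (v′ ∷ʳ b) =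
    majs-∷ʳ-shuffle-↭-gaussian _ u′ a v′ b refl u#v

-- Changing the alphabet

Below : {B : Set} → Rel B 0ℓ → List B → List B → Set
Below _≺_ xs ys = ∀ {x y} → x ∈ xs → y ∈ ys → x ≺ y

module OrderTransfer {A B : Set} {_<_ : Rel A 0ℓ} {_<′_ : Rel B 0ℓ}
    (sto : IsStrictTotalOrder _≡_ _<_) (sto′ : IsStrictTotalOrder _≡_ _<′_) where
  open WordOps sto
  open Descents sto
  module W′ = WordOps sto′
  module D′ = Descents sto′
  open IsStrictTotalOrder sto using (_<?_) renaming (asym to <-asymᴬ)
  open IsStrictTotalOrder sto′ using () renaming (irrefl to <′-irrefl; asym to <′-asym)

  desc-cong : ∀ {x y x′ y′} i → (y < x → y′ <′ x′) → (y′ <′ x′ → y < x) → desc x y i ≡ W′.desc x′ y′ i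
  desc-cong {x} {y} {x′} {y′} i to from = cases (y <? x)
    where
    cases : Dec (y < x) → desc x y i ≡ W′.desc x′ y′ i
    cases (yes y<x) = trans (desc-< i y<x) (sym (D′.desc-< i (to y<x)))
    cases (no y≮x)  = trans (desc-≮ i y≮x) (sym (D′.desc-≮ i (y≮x ∘ from)))

  module _ (f : A → B) (mono : ∀ {x y} → x < y → f x <′ f y) (reflect : ∀ {x y} → f x <′ f y → x < y) where

    majFrom-map : ∀ i x w → W′.majFrom i (f x) (map f w) ≡ majFrom i x w
    majFrom-map i x []      = refl
    majFrom-map i x (y ∷ w) = cong₂ _+_ (sym (desc-cong i mono reflect)) (majFrom-map (suc i) y w)

    maj-map : ∀ w → W′.maj (map f w) ≡ maj w
    maj-map []      = refl
    maj-map (x ∷ w) = majFrom-map 1 x w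

  Below⇒Disjoint : ∀ {xs ys} → Below _<′_ xs ys → Disjoint xs ys
  Below⇒Disjoint xs<ys (p , q) = <′-irrefl refl (xs<ys p q)

  majs-halfShuffle-transfer : ∀ u′ a v′ b σ τ → Disjoint (u′ ∷ʳ a) (v′ ∷ʳ b) →
    length σ ≡ length (u′ ∷ʳ a) → length τ ≡ length (v′ ∷ʳ b) →
    W′.maj σ ≡ maj (u′ ∷ʳ a) → W′.maj τ ≡ maj (v′ ∷ʳ b) →
    (a < b × Below _<′_ σ τ) ⊎ (b < a × Below _<′_ τ σ) →
    map maj (halfShuffle (u′ ∷ʳ a) (v′ ∷ʳ b)) ↭ map W′.maj (halfShuffle σ τ)
  majs-halfShuffle-transfer u′ a v′ b σ τ u#v |σ| |τ| majσ majτ sides with initLast σ | initLast τ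
  ... | [] | _ = ⊥-elim (0≢1+n (trans |σ| (length-∷ʳ u′ a)))
  ... | _ ∷ʳ′ _ | [] = ⊥-elim (0≢1+n (trans |τ| (length-∷ʳ v′ b)))
  ... | σ′ ∷ʳ′ x | τ′ ∷ʳ′ y = begin
    map maj (halfShuffle (u′ ∷ʳ a) (v′ ∷ʳ b))
      ↭⟨ majs-halfShuffle-↭-gaussian u′ a v′ b u#v ⟩
    shift (gaussian (length u′) (suc (length v′))) (majOffset u′ a v′ b)
      ≡⟨ cong₂ (λ k l → shift (gaussian k (suc l)) (majOffset u′ a v′ b)) |σ′|≡|u′| |τ′|≡|v′| ⟨
    shift (gaussian (length σ′) (suc (length τ′))) (majOffset u′ a v′ b)
      ≡⟨ cong (shift (gaussian (length σ′) (suc (length τ′)))) offsets ⟨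
    shift (gaussian (length σ′) (suc (length τ′))) (D′.majOffset σ′ x τ′ y)
      ↭⟨ ↭-sym (D′.majs-halfShuffle-↭-gaussian σ′ x τ′ y σ#τ) ⟩
    map W′.maj (halfShuffle (σ′ ∷ʳ x) (τ′ ∷ʳ y))
      ∎
    where
    open PermutationReasoning
    |σ′|≡|u′| : length σ′ ≡ length u′
    |σ′|≡|u′| = suc-injective (trans (sym (length-∷ʳ σ′ x)) (trans |σ| (length-∷ʳ u′ a)))
    |τ′|≡|v′| : length τ′ ≡ length v′
    |τ′|≡|v′| = suc-injective (trans (sym (length-∷ʳ τ′ y)) (trans |τ| (length-∷ʳ v′ b)))
    σ#τ : Disjoint (σ′ ∷ʳ x) (τ′ ∷ʳ y)
    σ#τ = case sides of λ where
      (inj₁ (_ , σ<τ)) → Below⇒Disjoint σ<τ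
      (inj₂ (_ , τ<σ)) → λ (p , q) → Below⇒Disjoint τ<σ (q , p)
    lastDescent : ∀ i → desc b a i ≡ W′.desc y x i
    lastDescent i = case sides of λ where
      (inj₁ (a<b , σ<τ)) → desc-cong i (λ _ → σ<τ (∈-∷ʳ σ′ x) (∈-∷ʳ τ′ y)) (λ _ → a<b)
      (inj₂ (b<a , τ<σ)) → desc-cong i (λ a<b → ⊥-elim (<-asymᴬ a<b b<a))
                                       (λ x<y → ⊥-elim (<′-asym x<y (τ<σ (∈-∷ʳ τ′ y) (∈-∷ʳ σ′ x))))
    offsets : D′.majOffset σ′ x τ′ y ≡ majOffset u′ a v′ b
    offsets = cong₂ _+_ (cong₂ _+_ majσ majτ)
      (trans (cong (λ l → W′.desc y x (suc l)) |τ′|≡|v′|) (sym (lastDescent (suc (length v′)))))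

maj-shift : ∀ w k → ℕWords.maj (shift w k) ≡ ℕWords.maj w
maj-shift w k = OrderTransfer.maj-map <-isStrictTotalOrder <-isStrictTotalOrder (_+ k) (+-monoˡ-< k) (+-cancelʳ-< k _ _) w

Below-shift : ∀ {σ τ k} → All (_≤ k) σ → All (1 ≤_) τ → Below ℕ._<_ σ (shift τ k)
Below-shift {k = k} σ≤k 1≤τ x∈σ y∈τ+k with ∈-map⁻ (_+ k) y∈τ+k
... | z , z∈τ , refl = ≤-<-trans (All.lookup σ≤k x∈σ) (+-monoˡ-≤ k (All.lookup 1≤τ z∈τ))

-- Standardization

module _ {A : Set} where

  count : {P : A → Set} → Decidable P → List A → ℕ
  count P? xs = length (filter P? xs)

  module _ {P : A → Set} (P? : Decidable P) where

    count-++ : ∀ xs ys → count P? (xs ++ ys) ≡ count P? xs + count P? ys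
    count-++ xs ys = trans (cong length (filter-++ P? xs ys)) (length-++ (filter P? xs))

    count-∷ʳ-accept : ∀ {x} xs → P x → count P? (xs ∷ʳ x) ≡ suc (count P? xs)
    count-∷ʳ-accept {x} xs px =
      trans (count-++ xs (x ∷ [])) (trans (cong (λ ys → count P? xs + length ys) (filter-accept P? px)) (+-comm _ 1))

    count-<-after : ∀ {x} xs ys → P x → count P? xs ℕ.< count P? (xs ++ x ∷ ys)
    count-<-after {x} xs ys px = begin-strict
      count P? xs                                ≤⟨ m≤m+n _ _ ⟩
      count P? xs + count P? ys                  <⟨ +-monoʳ-< (count P? xs) (n<1+n _) ⟩
      count P? xs + suc (count P? ys)            ≡⟨ cong (λ zs → count P? xs + length zs) (filter-accept P? px) ⟨
      count P? xs + count P? (x ∷ ys)            ≡⟨ count-++ xs (x ∷ ys) ⟨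
      count P? (xs ++ x ∷ ys)                    ∎
      where open ≤-Reasoning

  count-disjoint-≤ : ∀ {P Q R : A → Set} (P? : Decidable P) (Q? : Decidable Q) (R? : Decidable R) →
    (∀ {z} → P z → R z) → (∀ {z} → Q z → R z) → (∀ {z} → P z → Q z → ⊥) →
    ∀ xs → count P? xs + count Q? xs ≤ count R? xs
  count-disjoint-≤ P? Q? R? P⇒R Q⇒R P#Q [] = z≤n
  count-disjoint-≤ P? Q? R? P⇒R Q⇒R P#Q (z ∷ xs) with P? z | Q? z | R? z
  ... | yes p | yes q | _     = ⊥-elim (P#Q p q)
  ... | yes p | no _  | no ¬r = ⊥-elim (¬r (P⇒R p))
  ... | no _  | yes q | no ¬r = ⊥-elim (¬r (Q⇒R q))
  ... | yes _ | no _  | yes _ = s≤s (count-disjoint-≤ P? Q? R? P⇒R Q⇒R P#Q xs)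
  ... | no _  | yes _ | yes _ =
    subst (_≤ suc (count R? xs)) (sym (+-suc _ _)) (s≤s (count-disjoint-≤ P? Q? R? P⇒R Q⇒R P#Q xs))
  ... | no _  | no _  | yes _ = m≤n⇒m≤1+n (count-disjoint-≤ P? Q? R? P⇒R Q⇒R P#Q xs)
  ... | no _  | no _  | no _  = count-disjoint-≤ P? Q? R? P⇒R Q⇒R P#Q xs

  take-length-++ : ∀ (p r : List A) → take (length p) (p ++ r) ≡ p
  take-length-++ []      r = refl
  take-length-++ (x ∷ p) r = cong (x ∷_) (take-length-++ p r)

module Standardization {A : Set} {_<_ : Rel A 0ℓ} (sto : IsStrictTotalOrder _≡_ _<_) where
  open WordOps sto
  open IsStrictTotalOrder sto using (_<?_; _≟_; compare) renaming (trans to <-trans; irrefl to <-irrefl)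
  open OrderTransfer sto <-isStrictTotalOrder using (desc-cong)

  -- The letter that std w puts at an occurrence of x preceded by the prefix p of w.
  rank : List A → List A → A → ℕ
  rank w p x = suc (count (_<? x) w + count (_≟ x) p)

  stdFrom : List A → List A → List A → List ℕ
  stdFrom w p []      = []
  stdFrom w p (x ∷ r) = rank w p x ∷ stdFrom w (p ∷ʳ x) r

  stdFrom-zip : ∀ w (f : ℕ → ℕ) p r → (∀ t → f t ≡ length p + t) → w ≡ p ++ r →
    map (λ (i , x) → rank w (take i w) x) (zip (applyUpTo f (length r)) r) ≡ stdFrom w p r
  stdFrom-zip w f p []      f≡ w≡ = refl
  stdFrom-zip w f p (x ∷ r) f≡ w≡ = cong₂ _∷_
    (cong (λ q → rank w q x) (trans (cong₂ take (trans (f≡ 0) (+-comm (length p) 0)) w≡) (take-length-++ p (x ∷ r))))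
    (stdFrom-zip w (λ t → f (suc t)) (p ∷ʳ x) r
      (λ t → trans (f≡ (suc t)) (trans (+-suc (length p) t) (cong (_+ t) (sym (length-∷ʳ p x)))))
      (trans w≡ (sym (∷ʳ-++ p x r))))

  std≡stdFrom : ∀ w → std w ≡ stdFrom w [] w
  std≡stdFrom w = trans (map-cong (λ _ → refl) _) (stdFrom-zip w (λ t → t) [] w (λ _ → refl) refl)

  rank-≤-counts : ∀ {w p x} r → w ≡ p ++ x ∷ r → rank w p x ≤ count (_<? x) w + count (_≟ x) w
  rank-≤-counts {w} {p} {x} r w≡ = begin
    suc (count (_<? x) w + count (_≟ x) p) ≡⟨ +-suc _ _ ⟨
    count (_<? x) w + suc (count (_≟ x) p) ≤⟨ +-monoʳ-≤ _ (subst (λ v → count (_≟ x) p ℕ.< count (_≟ x) v) (sym w≡)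
                                                                   (count-<-after (_≟ x) p r refl)) ⟩
    count (_<? x) w + count (_≟ x) w       ∎
    where open ≤-Reasoning

  rank-< : ∀ {w p x y} r q → w ≡ p ++ x ∷ r → x < y → rank w p x ℕ.< rank w q y
  rank-< {w} {p} {x} {y} r q w≡ x<y = s≤s (begin
    rank w p x                              ≤⟨ rank-≤-counts r w≡ ⟩
    count (_<? x) w + count (_≟ x) w        ≤⟨ count-disjoint-≤ (_<? x) (_≟ x) (_<? y) (λ z<x → <-trans z<x x<y)
                                                 (λ { refl → x<y }) (λ { z<x refl → <-irrefl refl z<x }) w ⟩
    count (_<? y) w                         ≤⟨ m≤m+n _ _ ⟩
    count (_<? y) w + count (_≟ y) q        ∎)
    where open ≤-Reasoning

  rank-≤-length : ∀ {w p x} r → w ≡ p ++ x ∷ r → rank w p x ≤ length w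
  rank-≤-length {w} {p} {x} r w≡ = begin
    rank w p x                           ≤⟨ rank-≤-counts r w≡ ⟩
    count (_<? x) w + count (_≟ x) w     ≤⟨ count-disjoint-≤ (_<? x) (_≟ x) (λ _ → yes tt) _ _
                                              (λ { z<x refl → <-irrefl refl z<x }) w ⟩
    count (λ _ → yes tt) w               ≤⟨ length-filter (λ _ → yes tt) w ⟩
    length w                             ∎
    where open ≤-Reasoning

  rank-∷ʳ : ∀ w p x → rank w p x ℕ.< rank w (p ∷ʳ x) x
  rank-∷ʳ w p x = s≤s (+-monoʳ-< _ (≤-reflexive (sym (count-∷ʳ-accept (_≟ x) p refl))))

  desc-rank : ∀ {w} p x y r → w ≡ p ++ x ∷ y ∷ r → ∀ i →
    ℕWords.desc (rank w p x) (rank w (p ∷ʳ x) y) i ≡ desc x y i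
  desc-rank {w} p x y r w≡ i = sym (desc-cong i (rank-< r p w≡′) reflect)
    where
    w≡′ : w ≡ (p ∷ʳ x) ++ y ∷ r
    w≡′ = trans w≡ (sym (∷ʳ-++ p x (y ∷ r)))
    reflect : rank w (p ∷ʳ x) y ℕ.< rank w p x → y < x
    reflect y≺x with compare x y
    ... | tri< x<y _ _ = ⊥-elim (<-asym y≺x (rank-< (y ∷ r) (p ∷ʳ x) w≡ x<y))
    ... | tri≈ _ refl _ = ⊥-elim (<-asym y≺x (rank-∷ʳ w p x))
    ... | tri> _ _ y<x = y<x

  majFrom-stdFrom : ∀ {w} p x r → w ≡ p ++ x ∷ r → ∀ i →
    ℕWords.majFrom i (rank w p x) (stdFrom w (p ∷ʳ x) r) ≡ majFrom i x r
  majFrom-stdFrom p x []      w≡ i = refl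
  majFrom-stdFrom p x (y ∷ r) w≡ i = cong₂ _+_ (desc-rank p x y r w≡ i)
    (majFrom-stdFrom (p ∷ʳ x) y r (trans w≡ (sym (∷ʳ-++ p x (y ∷ r)))) (suc i))

  maj-std : ∀ w → ℕWords.maj (std w) ≡ maj w
  maj-std w = trans (cong ℕWords.maj (std≡stdFrom w)) (maj-stdFrom w refl)
    where
    maj-stdFrom : ∀ r → w ≡ r → ℕWords.maj (stdFrom w [] r) ≡ maj r
    maj-stdFrom []      _  = refl
    maj-stdFrom (x ∷ r) w≡ = majFrom-stdFrom [] x r w≡ 1

  length-std : ∀ w → length (std w) ≡ length w
  length-std w = trans (cong length (std≡stdFrom w)) (length-stdFrom [] w)
    where
    length-stdFrom : ∀ p r → length (stdFrom w p r) ≡ length r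
    length-stdFrom p []      = refl
    length-stdFrom p (x ∷ r) = cong suc (length-stdFrom (p ∷ʳ x) r)

  std-bounded : ∀ w → All (λ z → 1 ≤ z × z ≤ length w) (std w)
  std-bounded w = subst (All _) (sym (std≡stdFrom w)) (stdFrom-bounded [] w refl)
    where
    stdFrom-bounded : ∀ p r → w ≡ p ++ r → All (λ z → 1 ≤ z × z ≤ length w) (stdFrom w p r)
    stdFrom-bounded p []      _  = All.[]
    stdFrom-bounded p (x ∷ r) w≡ =
      (s≤s z≤n , rank-≤-length r w≡) All.∷ stdFrom-bounded (p ∷ʳ x) r (trans w≡ (sym (∷ʳ-++ p x r)))

  length-shift-std : ∀ w k → length (shift (std w) k) ≡ length w
  length-shift-std w k = trans (length-map (_+ k) (std w)) (length-std w)

  maj-shift-std : ∀ w k → ℕWords.maj (shift (std w) k) ≡ maj w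
  maj-shift-std w k = trans (maj-shift (std w) k) (maj-std w)

  std-Below-shift : ∀ u v → Below ℕ._<_ (std u) (shift (std v) (length u))
  std-Below-shift u v = Below-shift (All.map proj₂ (std-bounded u)) (All.map proj₁ (std-bounded v))

-- Generating functions

coeff-map : ∀ {A : Set} (f : A → ℕ) xs m → coeff f xs m ≡ coeff (λ n → n) (map f xs) m
coeff-map f []       m = refl
coeff-map f (x ∷ xs) m = cases (f x ℕ.≟ m)
  where
  cases : Dec (f x ≡ m) → coeff f (x ∷ xs) m ≡ coeff (λ n → n) (f x ∷ map f xs) m
  cases (yes fx≡m) = trans (cong length (filter-accept (λ y → f y ℕ.≟ m) fx≡m))
    (trans (cong suc (coeff-map f xs m)) (sym (cong length (filter-accept (ℕ._≟ m) fx≡m))))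
  cases (no fx≢m) = trans (cong length (filter-reject (λ y → f y ℕ.≟ m) fx≢m))
    (trans (coeff-map f xs m) (sym (cong length (filter-reject (ℕ._≟ m) fx≢m))))

coeff-↭ : ∀ {A B : Set} (f : A → ℕ) (g : B → ℕ) {xs ys} → map f xs ↭ map g ys → ∀ m → coeff f xs m ≡ coeff g ys m
coeff-↭ f g {xs} {ys} fxs↭gys m =
  trans (coeff-map f xs m) (trans (↭-length (filter-↭ (ℕ._≟ m) fxs↭gys)) (sym (coeff-map g ys m)))

corollary4p3 : {A : Set} {_<_ : Rel A 0ℓ} (sto : IsStrictTotalOrder _≡_ _<_)
    (u′ : List A) (a : A) (v′ : List A) (b : A) →
    (∀ c → c ∈ (u′ ∷ʳ a) → c ∈ (v′ ∷ʳ b) → ⊥) →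
    ((a < b) → ∀ m →
      coeff (WordOps.maj sto) (halfShuffle (u′ ∷ʳ a) (v′ ∷ʳ b)) m
        ≡ coeff ℕWords.maj (halfShuffle (WordOps.std sto (u′ ∷ʳ a)) (shift (WordOps.std sto (v′ ∷ʳ b)) (length (u′ ∷ʳ a)))) m)
    ×
    ((b < a) → ∀ m →
      coeff (WordOps.maj sto) (halfShuffle (u′ ∷ʳ a) (v′ ∷ʳ b)) m
        ≡ coeff ℕWords.maj (halfShuffle (shift (WordOps.std sto (u′ ∷ʳ a)) (length (v′ ∷ʳ b))) (WordOps.std sto (v′ ∷ʳ b))) m)
corollary4p3 sto u′ a v′ b disjoint = below , above
  where
  open WordOps sto using (maj; std)
  open OrderTransfer sto <-isStrictTotalOrder using (majs-halfShuffle-transfer)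
  open Standardization sto using (length-std; maj-std; length-shift-std; maj-shift-std; std-Below-shift)
  u = u′ ∷ʳ a
  v = v′ ∷ʳ b
  u#v : Disjoint u v
  u#v (p , q) = disjoint _ p q
  below = λ a<b → coeff-↭ maj ℕWords.maj (majs-halfShuffle-transfer u′ a v′ b _ _ u#v
    (length-std u) (length-shift-std v (length u)) (maj-std u) (maj-shift-std v (length u))
    (inj₁ (a<b , std-Below-shift u v)))
  above = λ b<a → coeff-↭ maj ℕWords.maj (majs-halfShuffle-transfer u′ a v′ b _ _ u#v
    (length-shift-std u (length v)) (length-std v) (maj-shift-std u (length v)) (maj-std v)
    (inj₂ (b<a , std-Below-shift v u)))
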